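{- For any monoidal signature $\Sigma$, models of GCQ over $\Sigma$ are in bijective correspondence with morphisms of cartesian bicategories $\mathbb{CB}_\Sigma\to\mathbf{Rel}$.
   Context: A monoidal signature $\Sigma$ is a set of symbols each with an arity $n$ and coarity $m$ ($\Sigma_{n,m}$ those with arity $n$, coarity $m$). A GCQ model $\mathcal M=(X,\rho)$ is a set $X$ together with, for each $R\in\Sigma_{n,m}$, a relation $\rho(R)\subseteq X^n\times X^m$. GCQ terms with sorts $(n,m)$ are generated by constants $\delta:(1,2)$, $\varepsilon:(1,0)$, $\mu:(2,1)$, $\eta:(0,1)$, $\mathrm{id}_0:(0,0)$, $\mathrm{id}_1:(1,1)$, $\sigma:(2,2)$, symbols $R\in\Sigma_{n,m}$, $c;d$ and $c\oplus d$ with the evident sorting. With $\mathrm{id}_n$, $\sigma_{n,m}$, $\varepsilon_0=\mathrm{id}_0$, $\varepsilon_{n+1}=\varepsilon\oplus\varepsilon_n$, $\delta_0=\mathrm{id}_0$, $\delta_{n+1}=(\delta\oplus\delta_n);(\mathrm{id}_1\oplus\sigma_{1,n}\oplus\mathrm{id}_n)$: equations (E) are the strict symmetric monoidal category laws (symmetry generated by $\sigma$), the commutative comonoid laws for $\delta,\varepsilon$, the commutative monoid laws for $\mu,\eta$, the Frobenius law $(\delta\oplus\mathrm{id}_1);(\mathrm{id}_1\oplus\mu)=\mu;\delta=(\mathrm{id}_1\oplus\delta);(\mu\oplus\mathrm{id}_1)$ and $\delta;\mu=\mathrm{id}_1$; inequalities (I) are $\mathrm{id}_1\le\varepsilon;\eta$,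 $\eta;\varepsilon\le\mathrm{id}_0$, $\mathrm{id}_1\le\delta;\mu$, $\mu;\delta\le\mathrm{id}_2$ and, for $R\in\Sigma_{n,m}$, $R;\delta_m\le\delta_n;(R\oplus R)$, $R;\varepsilon_m\le\varepsilon_n$. $\le_{\mathbb{CB}}$ is the smallest precongruence generated by (E) and (I); $\mathbb{CB}_\Sigma$ has arrows $n\to m$ the terms of sort $(n,m)$ modulo $\le_{\mathbb{CB}}\cap\ge_{\mathbb{CB}}$, ordered by $\le_{\mathbb{CB}}$; its monoid/comonoid on $n$ are the $n$-fold lifts of $\mu,\eta,\delta,\varepsilon$. $\mathbf{Rel}$ has sets as objects, relations $R\subseteq X\times Y$ as arrows $X\to Y$ ordered by inclusion, relational composition, tensor the cartesian product (unit $1=\{\bullet\}$), comonoid $\delta_X=\{(x,(x,x))\}$, $\varepsilon_X=\{(x,\bullet)\}$ and monoid $\mu_X=\{((x,x),x)\}$, $\eta_X=\{(\bullet,x)\}$. A cartesian bicategory is a symmetric monoidal category enriched over posets in which every object carries a special commutative Frobenius bimonoid $(\mu_X,\eta_X,\delta_X,\varepsilon_X)$ with $\mathrm{id}_X\le\varepsilon_X;\eta_X$, $\eta_X;\varepsilon_X\le\mathrm{id}_I$, $\mathrm{id}_X\le\delta_X;\mu_X$, $\mu_X;\delta_X\le\mathrm{id}_{X\oplus X}$, and every arrow $R:X\to Y$ satisfies $R;\delta_Y\le\delta_X;(R\oplus R)$, $R;\varepsilon_Y\le\varepsilon_X$. A morphism of cartesian bicategories is a functor preserving the tensor, the partial orders,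 and the monoid and comonoid on every object. -}

module Defs where

open import Level using (0ℓ) renaming (suc to lsuc)
open import Data.Nat using (ℕ; zero; suc; _+_)
open import Data.Nat.Properties using (+-assoc; +-identityʳ)
open import Data.Vec using (Vec; []; _∷_; _++_; take; drop)
open import Data.Product using (Σ; _×_; _,_; proj₁; proj₂; ∃-syntax)
open import Data.Unit using (⊤)
open import Relation.Binary.PropositionalEquality using (_≡_; refl; sym; cong)
open import Relation.Binary.Bundles using (Setoid)
open import Relation.Binary.Structures using (IsEquivalence)

-- Monoidal signature: Sym n m = Σ_{n,m}, the symbols of arity n, coarity m.

Signature : Set₁
Signature = ℕ → ℕ → Set

infixl 5 _⨾_
infixl 6 _⊕_

data Term (Sym : Signature) : ℕ → ℕ → Set where
  δ   : Term Sym 1 2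
  ε   : Term Sym 1 0
  μ   : Term Sym 2 1
  η   : Term Sym 0 1
  id₀ : Term Sym 0 0
  id₁ : Term Sym 1 1
  σ   : Term Sym 2 2
  gen : ∀ {n m} → Sym n m → Term Sym n m
  _⨾_ : ∀ {n k m} → Term Sym n k → Term Sym k m → Term Sym n m
  _⊕_ : ∀ {n m k l} → Term Sym n m → Term Sym k l → Term Sym (n + k) (m + l)

module _ {Sym : Signature} where

  -- transport of a term along equalities of its sort (needed because
  -- n + (k + p) and (n + k) + p are not definitionally equal)
  cast : ∀ {n n' m m'} → n ≡ n' → m ≡ m' → Term Sym n m → Term Sym n' m'
  cast refl refl c = c

  idₙ : ∀ n → Term Sym n n
  idₙ zero    = id₀
  idₙ (suc n) = id₁ ⊕ idₙ n

  σ₁ : ∀ m → Term Sym (suc m) (m + 1)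
  σ₁ zero    = id₁
  σ₁ (suc m) = (σ ⊕ idₙ m) ⨾ (id₁ ⊕ σ₁ m)

  σₙ : ∀ n m → Term Sym (n + m) (m + n)
  σₙ zero    m = cast refl (sym (+-identityʳ m)) (idₙ m)
  σₙ (suc n) m = (id₁ ⊕ σₙ n m) ⨾ cast refl (+-assoc m 1 n) (σ₁ m ⊕ idₙ n)

  εₙ : ∀ n → Term Sym n 0
  εₙ zero    = id₀
  εₙ (suc n) = ε ⊕ εₙ n

  ηₙ : ∀ n → Term Sym 0 n
  ηₙ zero    = id₀
  ηₙ (suc n) = η ⊕ ηₙ n

  δₙ : ∀ n → Term Sym n (n + n)
  δₙ zero    = id₀
  δₙ (suc n) = cast refl (cong suc (+-assoc n 1 n))
                 ((δ ⊕ δₙ n) ⨾ (id₁ ⊕ (σₙ 1 n ⊕ idₙ n)))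

  μₙ : ∀ n → Term Sym (n + n) n
  μₙ zero    = id₀
  μₙ (suc n) = cast (cong suc (+-assoc n 1 n)) refl
                 ((id₁ ⊕ (σₙ n 1 ⊕ idₙ n)) ⨾ (μ ⊕ μₙ n))

  infix 4 _≈ᴱ_
  data _≈ᴱ_ : ∀ {n m} → Term Sym n m → Term Sym n m → Set where
    ⨾-assoc : ∀ {n k l m} (c : Term Sym n k) (d : Term Sym k l) (e : Term Sym l m) →
              (c ⨾ d) ⨾ e ≈ᴱ c ⨾ (d ⨾ e)
    ⨾-idˡ   : ∀ {n m} (c : Term Sym n m) → idₙ n ⨾ c ≈ᴱ c
    ⨾-idʳ   : ∀ {n m} (c : Term Sym n m) → c ⨾ idₙ m ≈ᴱ c
    ⊕-assoc : ∀ {n m k l p q} (c : Term Sym n m) (d : Term Sym k l) (e : Term Sym p q) →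
              cast (+-assoc n k p) (+-assoc m l q) ((c ⊕ d) ⊕ e) ≈ᴱ c ⊕ (d ⊕ e)
    ⊕-idˡ   : ∀ {n m} (c : Term Sym n m) → id₀ ⊕ c ≈ᴱ c
    ⊕-idʳ   : ∀ {n m} (c : Term Sym n m) →
              cast (+-identityʳ n) (+-identityʳ m) (c ⊕ id₀) ≈ᴱ c
    ⊕-id    : ∀ n m → idₙ n ⊕ idₙ m ≈ᴱ idₙ (n + m)
    interchange : ∀ {n k m n' k' m'}
              (c : Term Sym n k) (d : Term Sym k m) (c' : Term Sym n' k') (d' : Term Sym k' m') →
              (c ⨾ d) ⊕ (c' ⨾ d') ≈ᴱ (c ⊕ c') ⨾ (d ⊕ d')
    σσ      : σ ⨾ σ ≈ᴱ id₁ ⊕ id₁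
    σₙ-inv  : ∀ n m → σₙ n m ⨾ σₙ m n ≈ᴱ idₙ (n + m)
    σₙ-nat  : ∀ {n m n' m'} (c : Term Sym n m) (d : Term Sym n' m') →
              (c ⊕ d) ⨾ σₙ m m' ≈ᴱ σₙ n n' ⨾ (d ⊕ c)
    δ-assoc : δ ⨾ (δ ⊕ id₁) ≈ᴱ δ ⨾ (id₁ ⊕ δ)
    δ-unitˡ : δ ⨾ (ε ⊕ id₁) ≈ᴱ id₁
    δ-unitʳ : δ ⨾ (id₁ ⊕ ε) ≈ᴱ id₁
    δ-comm  : δ ⨾ σ ≈ᴱ δ
    μ-assoc : (μ ⊕ id₁) ⨾ μ ≈ᴱ (id₁ ⊕ μ) ⨾ μ
    μ-unitˡ : (η ⊕ id₁) ⨾ μ ≈ᴱ id₁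
    μ-unitʳ : (id₁ ⊕ η) ⨾ μ ≈ᴱ id₁
    μ-comm  : σ ⨾ μ ≈ᴱ μ
    frobˡ   : (δ ⊕ id₁) ⨾ (id₁ ⊕ μ) ≈ᴱ μ ⨾ δ
    frobʳ   : (id₁ ⊕ δ) ⨾ (μ ⊕ id₁) ≈ᴱ μ ⨾ δ
    special : δ ⨾ μ ≈ᴱ id₁

  infix 4 _≤CB_
  data _≤CB_ : ∀ {n m} → Term Sym n m → Term Sym n m → Set where
    ≤-refl  : ∀ {n m} {c : Term Sym n m} → c ≤CB c
    ≤-trans : ∀ {n m} {c d e : Term Sym n m} → c ≤CB d → d ≤CB e → c ≤CB e
    ≤-⨾     : ∀ {n k m} {c c' : Term Sym n k} {d d' : Term Sym k m} →
              c ≤CB c' → d ≤CB d' → c ⨾ d ≤CB c' ⨾ d'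
    ≤-⊕     : ∀ {n m k l} {c c' : Term Sym n m} {d d' : Term Sym k l} →
              c ≤CB c' → d ≤CB d' → c ⊕ d ≤CB c' ⊕ d'
    eq→     : ∀ {n m} {c d : Term Sym n m} → c ≈ᴱ d → c ≤CB d
    eq←     : ∀ {n m} {c d : Term Sym n m} → c ≈ᴱ d → d ≤CB c
    ε-η     : id₁ ≤CB ε ⨾ η
    η-ε     : η ⨾ ε ≤CB id₀
    δ-μ     : id₁ ≤CB δ ⨾ μ
    μ-δ     : μ ⨾ δ ≤CB id₁ ⊕ id₁
    gen-δ   : ∀ {n m} (R : Sym n m) → gen R ⨾ δₙ m ≤CB δₙ n ⨾ (gen R ⊕ gen R)
    gen-ε   : ∀ {n m} (R : Sym n m) → gen R ⨾ εₙ m ≤CB εₙ n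

-- Rel, restricted to the objects X^n (n-fold products of a set X),
-- with X^n ⊗ X^m identified with X^(n+m) via concatenation.

module _ (X : Set) where

  VRel : ℕ → ℕ → Set₁
  VRel n m = Vec X n → Vec X m → Set

  infix 4 _⊆ᴿ_ _≐ᴿ_
  _⊆ᴿ_ : ∀ {n m} → VRel n m → VRel n m → Set
  R ⊆ᴿ S = ∀ u v → R u v → S u v

  _≐ᴿ_ : ∀ {n m} → VRel n m → VRel n m → Set
  R ≐ᴿ S = R ⊆ᴿ S × S ⊆ᴿ R

  idᴿ : ∀ n → VRel n n
  idᴿ n u v = u ≡ v

  _⨾ᴿ_ : ∀ {n k m} → VRel n k → VRel k m → VRel n m
  (R ⨾ᴿ S) u w = ∃[ v ] (R u v × S v w)

  _⊗ᴿ_ : ∀ {n m k l} → VRel n m → VRel k l → VRel (n + k) (m + l)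
  _⊗ᴿ_ {n} {m} R S u v = R (take n u) (take m v) × S (drop n u) (drop m v)

  swapᴿ : ∀ n m → VRel (n + m) (m + n)
  swapᴿ n m u v = v ≡ drop n u ++ take n u

  δᴿ : ∀ n → VRel n (n + n)
  δᴿ n u v = v ≡ u ++ u

  εᴿ : ∀ n → VRel n 0
  εᴿ n u v = ⊤

  μᴿ : ∀ n → VRel (n + n) n
  μᴿ n u v = u ≡ v ++ v

  ηᴿ : ∀ n → VRel 0 n
  ηᴿ n u v = ⊤

record Model (Sym : Signature) (X : Set) : Set₁ where
  field
    ρ : ∀ {n m} → Sym n m → VRel X n m

_≈Model_ : ∀ {Sym X} → Model Sym X → Model Sym X → Set
_≈Model_ {Sym} {X} M N = ∀ {n m} (R : Sym n m) → _≐ᴿ_ X (Model.ρ M R) (Model.ρ N R)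

-- Morphisms of cartesian bicategories CB_Σ → Rel sending the object 1
-- to X (hence, being strict monoidal, the object n to X^n).
-- An arrow map on the quotient CB_Σ is a map on terms that is monotone
-- for ≤CB (hence constant on ≤CB ∩ ≥CB-classes).

record CBMorphism (Sym : Signature) (X : Set) : Set₁ where
  field
    F       : ∀ {n m} → Term Sym n m → VRel X n m
    mono    : ∀ {n m} {c d : Term Sym n m} → c ≤CB d → _⊆ᴿ_ X (F c) (F d)
    pres-⨾  : ∀ {n k m} (c : Term Sym n k) (d : Term Sym k m) →
              _≐ᴿ_ X (F (c ⨾ d)) (_⨾ᴿ_ X (F c) (F d))
    pres-id : ∀ n → _≐ᴿ_ X (F (idₙ n)) (idᴿ X n)
    pres-⊕  : ∀ {n m k l} (c : Term Sym n m) (d : Term Sym k l) →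
              _≐ᴿ_ X (F (c ⊕ d)) (_⊗ᴿ_ X (F c) (F d))
    pres-σ  : ∀ n m → _≐ᴿ_ X (F (σₙ n m)) (swapᴿ X n m)
    pres-δ  : ∀ n → _≐ᴿ_ X (F (δₙ n)) (δᴿ X n)
    pres-ε  : ∀ n → _≐ᴿ_ X (F (εₙ n)) (εᴿ X n)
    pres-μ  : ∀ n → _≐ᴿ_ X (F (μₙ n)) (μᴿ X n)
    pres-η  : ∀ n → _≐ᴿ_ X (F (ηₙ n)) (ηᴿ X n)

_≈Mor_ : ∀ {Sym X} → CBMorphism Sym X → CBMorphism Sym X → Set
_≈Mor_ {Sym} {X} F G = ∀ {n m} (c : Term Sym n m) →
  _≐ᴿ_ X (CBMorphism.F F c) (CBMorphism.F G c)

private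
  ≐-refl : ∀ {X n m} {R : VRel X n m} → _≐ᴿ_ X R R
  ≐-refl = (λ _ _ r → r) , (λ _ _ r → r)
  ≐-sym : ∀ {X n m} {R S : VRel X n m} → _≐ᴿ_ X R S → _≐ᴿ_ X S R
  ≐-sym (f , g) = g , f
  ≐-trans : ∀ {X n m} {R S T : VRel X n m} → _≐ᴿ_ X R S → _≐ᴿ_ X S T → _≐ᴿ_ X R T
  ≐-trans (f , g) (f' , g') = (λ u v r → f' u v (f u v r)) , (λ u v r → g u v (g' u v r))

ModelSetoid : Signature → Set → Setoid (lsuc 0ℓ) 0ℓ
ModelSetoid Sym X = record
  { Carrier = Model Sym X
  ; _≈_ = _≈Model_
  ; isEquivalence = record
    { refl = λ R → ≐-refl
    ; sym = λ p R → ≐-sym (p R)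
    ; trans = λ p q R → ≐-trans (p R) (q R) } }

MorphismSetoid : Signature → Set → Setoid (lsuc 0ℓ) 0ℓ
MorphismSetoid Sym X = record
  { Carrier = CBMorphism Sym X
  ; _≈_ = _≈Mor_
  ; isEquivalence = record
    { refl = λ c → ≐-refl
    ; sym = λ p c → ≐-sym (p c)
    ; trans = λ p q c → ≐-trans (p c) (q c) } }

-- A model ρ with carrier X has a canonical interpretation ⟦_⟧ of terms in Rel,
-- defined by structural recursion (a term of sort (n , m) denotes a relation
-- between X^n and X^m).  The theorem rests on two facts.
--   * Soundness: ⟦_⟧ is a morphism of cartesian bicategories.  It preserves ⨾ and ⊕
--     by definition; that it sends the derived terms idₙ, σₙ, δₙ, μₙ, εₙ, ηₙ to the
--     structure of Rel is proved by induction, computing the relations denoted by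
--     the structural terms as graphs of functions on vectors; and it is monotone
--     for ≤CB because Rel satisfies (E) and (I).
--   * Freeness: a morphism G is determined by its values on the generators, since
--     the constants of the syntax agree up to ≤CB ∩ ≥CB with the n-fold structure
--     at n = 1, which G preserves, and G preserves ⨾ and ⊕.
-- Hence "interpret" and "restrict to generators" are mutually inverse.

module Submission where

open import Defs
open import Level using (0ℓ) renaming (suc to lsuc)
open import Data.Nat using (ℕ; zero; suc; _+_)
open import Data.Nat.Properties using (+-assoc; +-identityʳ)
open import Data.Vec using (Vec; []; _∷_; _++_; take; drop; splitAt)
  renaming (cast to castᵛ)
open import Data.Vec.Properties
  using (take++drop≡id; cast-is-id; cast-sym; ++-assoc-eqFree; ++-identityʳ-eqFree)
open import Data.Product using (_×_; _,_; proj₁; proj₂)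
open import Data.Unit using (tt)
open import Function using (_∘_; id)
open import Relation.Binary.PropositionalEquality
open import Relation.Binary.Bundles using (Setoid)
import Relation.Binary.Reasoning.Setoid as SetoidReasoning
open import Function.Bundles using (Inverse)

module _ {A : Set} where

  take-++ : ∀ {n k} (a : Vec A n) (b : Vec A k) → take n (a ++ b) ≡ a
  take-++ []      b = refl
  take-++ (x ∷ a) b = cong (x ∷_) (take-++ a b)

  drop-++ : ∀ {n k} (a : Vec A n) (b : Vec A k) → drop n (a ++ b) ≡ b
  drop-++ []      b = refl
  drop-++ (x ∷ a) b = drop-++ a b

  cast-++-assoc : ∀ {n k p} (a : Vec A n) (b : Vec A k) (c : Vec A p) →
                  castᵛ (sym (+-assoc n k p)) (a ++ (b ++ c)) ≡ (a ++ b) ++ c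
  cast-++-assoc a b c = cast-sym _ (++-assoc-eqFree a b c)

  cast-++-[] : ∀ {n} (a : Vec A n) → castᵛ (sym (+-identityʳ n)) a ≡ a ++ []
  cast-++-[] a = cast-sym _ (++-identityʳ-eqFree a)

module Relations (X : Set) where

  Rel : ℕ → ℕ → Set₁
  Rel = VRel X

  infix  4 _⊆_ _≐_
  infixr 6 _⊗_
  infixl 5 _⨟_

  _⊆_ : ∀ {n m} → Rel n m → Rel n m → Set
  _⊆_ = _⊆ᴿ_ X

  -- Equality of relations, as a record so that both relations can be inferred
  -- from a proof; it is interderivable with _≐ᴿ_.
  record _≐_ {n m} (R S : Rel n m) : Set where
    constructor _,_
    field
      to   : R ⊆ S
      from : S ⊆ R

  ≐⇒≐ᴿ : ∀ {n m} {R S : Rel n m} → R ≐ S → _≐ᴿ_ X R S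
  ≐⇒≐ᴿ (f , g) = f , g

  ≐ᴿ⇒≐ : ∀ {n m} {R S : Rel n m} → _≐ᴿ_ X R S → R ≐ S
  ≐ᴿ⇒≐ (f , g) = f , g

  _⨟_ : ∀ {n k m} → Rel n k → Rel k m → Rel n m
  _⨟_ = _⨾ᴿ_ X

  _⊗_ : ∀ {n m k l} → Rel n m → Rel k l → Rel (n + k) (m + l)
  _⊗_ = _⊗ᴿ_ X

  ≐-refl : ∀ {n m} {R : Rel n m} → R ≐ R
  ≐-refl = (λ _ _ r → r) , (λ _ _ r → r)

  ≐-sym : ∀ {n m} {R S : Rel n m} → R ≐ S → S ≐ R
  ≐-sym (f , g) = g , f

  ≐-trans : ∀ {n m} {R S T : Rel n m} → R ≐ S → S ≐ T → R ≐ T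
  ≐-trans (f , g) (f' , g') = (λ u v r → f' u v (f u v r)) , (λ u v r → g u v (g' u v r))

  ≐-setoid : ℕ → ℕ → Setoid (lsuc 0ℓ) 0ℓ
  ≐-setoid n m = record
    { Carrier = Rel n m
    ; _≈_ = _≐_
    ; isEquivalence = record { refl = ≐-refl ; sym = ≐-sym ; trans = ≐-trans } }

  module ≐-Reasoning {n m : ℕ} = SetoidReasoning (≐-setoid n m)

  ⊆-trans : ∀ {n m} {R S T : Rel n m} → R ⊆ S → S ⊆ T → R ⊆ T
  ⊆-trans f g u v r = g u v (f u v r)

  ⨟-mono : ∀ {n k m} {R R' : Rel n k} {S S' : Rel k m} → R ⊆ R' → S ⊆ S' → R ⨟ S ⊆ R' ⨟ S'
  ⨟-mono f g u w (v , p , q) = v , f u v p , g v w q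

  ⊗-mono : ∀ {n m k l} {R R' : Rel n m} {S S' : Rel k l} → R ⊆ R' → S ⊆ S' → R ⊗ S ⊆ R' ⊗ S'
  ⊗-mono f g u v (p , q) = f _ _ p , g _ _ q

  ⨟-cong : ∀ {n k m} {R R' : Rel n k} {S S' : Rel k m} → R ≐ R' → S ≐ S' → R ⨟ S ≐ R' ⨟ S'
  ⨟-cong (f , g) (f' , g') = ⨟-mono f f' , ⨟-mono g g'

  ⊗-cong : ∀ {n m k l} {R R' : Rel n m} {S S' : Rel k l} → R ≐ R' → S ≐ S' → R ⊗ S ≐ R' ⊗ S'
  ⊗-cong (f , g) (f' , g') = ⊗-mono f f' , ⊗-mono g g'

  ⨟-congˡ : ∀ {n k m} {R R' : Rel n k} (S : Rel k m) → R ≐ R' → R ⨟ S ≐ R' ⨟ S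
  ⨟-congˡ S p = ⨟-cong p (≐-refl {R = S})

  ⨟-congʳ : ∀ {n k m} (R : Rel n k) {S S' : Rel k m} → S ≐ S' → R ⨟ S ≐ R ⨟ S'
  ⨟-congʳ R p = ⨟-cong (≐-refl {R = R}) p

  ⊗-congʳ : ∀ {n m k l} (R : Rel n m) {S S' : Rel k l} → S ≐ S' → R ⊗ S ≐ R ⊗ S'
  ⊗-congʳ R p = ⊗-cong (≐-refl {R = R}) p

  ⊗-intro : ∀ {n m k l} (R : Rel n m) (S : Rel k l) {a b c d} →
            R a c → S b d → (R ⊗ S) (a ++ b) (c ++ d)
  ⊗-intro R S {a} {b} {c} {d} r s =
    subst₂ R (sym (take-++ a b)) (sym (take-++ c d)) r ,
    subst₂ S (sym (drop-++ a b)) (sym (drop-++ c d)) s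

  ⊗-elim : ∀ {n m k l} (R : Rel n m) (S : Rel k l)
           (a : Vec X n) (b : Vec X k) (c : Vec X m) (d : Vec X l) →
           (R ⊗ S) (a ++ b) (c ++ d) → R a c × S b d
  ⊗-elim R S a b c d (r , s) =
    subst₂ R (take-++ a b) (take-++ c d) r , subst₂ S (drop-++ a b) (drop-++ c d) s

  _ᵒ : ∀ {n m} → Rel n m → Rel m n
  (R ᵒ) u v = R v u

  ᵒ-cong : ∀ {n m} {R S : Rel n m} → R ≐ S → R ᵒ ≐ S ᵒ
  ᵒ-cong (f , g) = (λ u v → f v u) , (λ u v → g v u)

  ⨟-ᵒ : ∀ {n k m} (R : Rel n k) (S : Rel k m) → (R ⨟ S) ᵒ ≐ S ᵒ ⨟ R ᵒ
  ⨟-ᵒ R S = (λ { u w (v , p , q) → v , q , p }) , (λ { u w (v , p , q) → v , q , p })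

  idᴿ-ᵒ : ∀ n → idᴿ X n ≐ idᴿ X n ᵒ
  idᴿ-ᵒ n = (λ u v → sym) , (λ u v → sym)

  castᴿ : ∀ {n n' m m'} → n ≡ n' → m ≡ m' → Rel n m → Rel n' m'
  castᴿ p q R u v = R (castᵛ (sym p) u) (castᵛ (sym q) v)

  castᴿ-cong : ∀ {n n' m m'} (p : n ≡ n') (q : m ≡ m') {R S : Rel n m} →
               R ≐ S → castᴿ p q R ≐ castᴿ p q S
  castᴿ-cong p q (f , g) = (λ u v → f _ _) , (λ u v → g _ _)

  castᴿ-refl : ∀ {n m} (R : Rel n m) → castᴿ refl refl R ≐ R
  castᴿ-refl R = (λ u v → subst₂ R (cast-is-id refl u) (cast-is-id refl v))
               , (λ u v → subst₂ R (sym (cast-is-id refl u)) (sym (cast-is-id refl v)))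

  -- The structural relations δᴿ, swapᴿ and (up to
  -- symmetry) idᴿ are graphs, and graphs compose and tensor as their functions do,
  -- so facts about them reduce to equations between vectors.
  graph : ∀ {n m} → (Vec X n → Vec X m) → Rel n m
  graph f u v = v ≡ f u

  graph-cong : ∀ {n m} {f g : Vec X n → Vec X m} → (∀ u → f u ≡ g u) → graph f ≐ graph g
  graph-cong f≗g = (λ u v p → trans p (f≗g u)) , (λ u v p → trans p (sym (f≗g u)))

  -- The identity on vectors of a given length (fixing the length for inference).
  idᶠ : ∀ n → Vec X n → Vec X n
  idᶠ n = id

  idᴿ-graph : ∀ n → idᴿ X n ≐ graph (idᶠ n)
  idᴿ-graph n = (λ u v → sym) , (λ u v → sym)

  graph-⨟ : ∀ {n k m} (f : Vec X n → Vec X k) (g : Vec X k → Vec X m) →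
            graph f ⨟ graph g ≐ graph (g ∘ f)
  graph-⨟ f g = (λ { u w (v , refl , q) → q }) , (λ u w q → f u , refl , q)

  _⊗ᶠ_ : ∀ {n m k l} → (Vec X n → Vec X m) → (Vec X k → Vec X l) →
         Vec X (n + k) → Vec X (m + l)
  _⊗ᶠ_ {n} f g u = f (take n u) ++ g (drop n u)

  graph-⊗ : ∀ {n m k l} (f : Vec X n → Vec X m) (g : Vec X k → Vec X l) →
            graph f ⊗ graph g ≐ graph (f ⊗ᶠ g)
  graph-⊗ {n} {m} f g = to , from
    where
    to : graph f ⊗ graph g ⊆ graph (f ⊗ᶠ g)
    to u v (p , q) = trans (sym (take++drop≡id m v)) (cong₂ _++_ p q)
    from : graph (f ⊗ᶠ g) ⊆ graph f ⊗ graph g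
    from u v refl = take-++ (f (take n u)) _ , drop-++ (f (take n u)) _

  graph-cast : ∀ {n m m'} (q : m ≡ m') (f : Vec X n → Vec X m) →
               castᴿ refl q (graph f) ≐ graph (castᵛ q ∘ f)
  graph-cast q f = to , from
    where
    to : castᴿ refl q (graph f) ⊆ graph (castᵛ q ∘ f)
    to u v p = sym (cast-sym (sym q) (trans p (cong f (cast-is-id refl u))))
    from : graph (castᵛ q ∘ f) ⊆ castᴿ refl q (graph f)
    from u v p = trans (cast-sym q (sym p)) (cong f (sym (cast-is-id refl u)))

  graph-inverse : ∀ {n m} (f : Vec X n → Vec X m) (g : Vec X m → Vec X n) →
                  (∀ u → g (f u) ≡ u) → (∀ v → f (g v) ≡ v) → graph f ≐ graph g ᵒ
  graph-inverse f g gf fg = (λ { u v refl → sym (gf u) }) , (λ { u v refl → sym (fg v) })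

  swap : ∀ n m → Vec X (n + m) → Vec X (m + n)
  swap n m u = drop n u ++ take n u

  swap-++ : ∀ {n m} (a : Vec X n) (b : Vec X m) → swap n m (a ++ b) ≡ b ++ a
  swap-++ a b = cong₂ _++_ (drop-++ a b) (take-++ a b)

  swap-involutive : ∀ n m (u : Vec X (n + m)) → swap m n (swap n m u) ≡ u
  swap-involutive n m u = trans (swap-++ (drop n u) (take n u)) (take++drop≡id n u)

  swapᴿ-ᵒ : ∀ n m → swapᴿ X n m ≐ swapᴿ X m n ᵒ
  swapᴿ-ᵒ n m = graph-inverse (swap n m) (swap m n) (swap-involutive n m) (swap-involutive m n)

  ⨟-assoc : ∀ {n k l m} (R : Rel n k) (S : Rel k l) (T : Rel l m) → (R ⨟ S) ⨟ T ≐ R ⨟ (S ⨟ T)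
  ⨟-assoc R S T = (λ { u w (v , (t , p , q) , r) → t , p , (v , q , r) })
                , (λ { u w (t , p , (v , q , r)) → v , (t , p , q) , r })

  ⨟-identityˡ : ∀ {n m} (R : Rel n m) → idᴿ X n ⨟ R ≐ R
  ⨟-identityˡ R = (λ { u v (.u , refl , r) → r }) , (λ u v r → u , refl , r)

  ⨟-identityʳ : ∀ {n m} (R : Rel n m) → R ⨟ idᴿ X m ≐ R
  ⨟-identityʳ R = (λ { u v (.v , r , refl) → r }) , (λ u v r → v , r , refl)

  ⊗-identityˡ : ∀ {n m} (R : Rel n m) → idᴿ X 0 ⊗ R ≐ R
  ⊗-identityˡ R = (λ u v → proj₂) , (λ u v r → refl , r)

  ⊗-identityʳ : ∀ {n m} (R : Rel n m) →
                castᴿ (+-identityʳ n) (+-identityʳ m) (R ⊗ idᴿ X 0) ≐ R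
  ⊗-identityʳ {n} {m} R = to , from
    where
    to : castᴿ (+-identityʳ n) (+-identityʳ m) (R ⊗ idᴿ X 0) ⊆ R
    to u v r = proj₁ (⊗-elim R (idᴿ X 0) u [] v []
                         (subst₂ (R ⊗ idᴿ X 0) (cast-++-[] u) (cast-++-[] v) r))
    from : R ⊆ castᴿ (+-identityʳ n) (+-identityʳ m) (R ⊗ idᴿ X 0)
    from u v r = subst₂ (R ⊗ idᴿ X 0) (sym (cast-++-[] u)) (sym (cast-++-[] v))
                        (⊗-intro R (idᴿ X 0) r refl)

  ⊗-assoc : ∀ {n m k l p q} (R : Rel n m) (S : Rel k l) (T : Rel p q) →
            castᴿ (+-assoc n k p) (+-assoc m l q) ((R ⊗ S) ⊗ T) ≐ R ⊗ (S ⊗ T)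
  ⊗-assoc {n} {m} {k} {l} {p} {q} R S T = to , from
    where
    RST : Rel ((n + k) + p) ((m + l) + q)
    RST = (R ⊗ S) ⊗ T
    to : castᴿ (+-assoc n k p) (+-assoc m l q) RST ⊆ R ⊗ (S ⊗ T)
    to u v h with splitAt n u | splitAt m v
    ... | a , bc , refl | x , yz , refl with splitAt k bc | splitAt l yz
    ... | b , c , refl | y , z , refl =
      let rs , t = ⊗-elim (R ⊗ S) T (a ++ b) c (x ++ y) z
                     (subst₂ RST (cast-++-assoc a b c) (cast-++-assoc x y z) h)
          r , s  = ⊗-elim R S a b x y rs
      in r , s , t
    from : R ⊗ (S ⊗ T) ⊆ castᴿ (+-assoc n k p) (+-assoc m l q) RST
    from u v h with splitAt n u | splitAt m v
    ... | a , bc , refl | x , yz , refl with splitAt k bc | splitAt l yz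
    ... | b , c , refl | y , z , refl =
      let r , s , t = h
      in subst₂ RST (sym (cast-++-assoc a b c)) (sym (cast-++-assoc x y z))
                (⊗-intro (R ⊗ S) T (⊗-intro R S r s) t)

  ⊗-id : ∀ n k → idᴿ X n ⊗ idᴿ X k ≐ idᴿ X (n + k)
  ⊗-id n k = to , from
    where
    to : idᴿ X n ⊗ idᴿ X k ⊆ idᴿ X (n + k)
    to u v (p , q) = trans (sym (take++drop≡id n u)) (trans (cong₂ _++_ p q) (take++drop≡id n v))
    from : idᴿ X (n + k) ⊆ idᴿ X n ⊗ idᴿ X k
    from u .u refl = refl , refl

  ⨟-⊗-interchange : ∀ {n k m n' k' m'} (R : Rel n k) (S : Rel k m) (R' : Rel n' k') (S' : Rel k' m') →
                (R ⨟ S) ⊗ (R' ⨟ S') ≐ (R ⊗ R') ⨟ (S ⊗ S')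
  ⨟-⊗-interchange {n} {k} R S R' S' = to , from
    where
    to : (R ⨟ S) ⊗ (R' ⨟ S') ⊆ (R ⊗ R') ⨟ (S ⊗ S')
    to u w ((v , p , q) , (v' , p' , q')) =
      v ++ v' ,
      (subst (R (take n u)) (sym (take-++ v v')) p , subst (R' (drop n u)) (sym (drop-++ v v')) p') ,
      (subst (λ t → S t _) (sym (take-++ v v')) q , subst (λ t → S' t _) (sym (drop-++ v v')) q')
    from : (R ⊗ R') ⨟ (S ⊗ S') ⊆ (R ⨟ S) ⊗ (R' ⨟ S')
    from u w (t , (p , p') , (q , q')) = (take k t , p , q) , (drop k t , p' , q')

  swap-inverse : ∀ n m → swapᴿ X n m ⨟ swapᴿ X m n ≐ idᴿ X (n + m)
  swap-inverse n m = begin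
    graph (swap n m) ⨟ graph (swap m n) ≈⟨ graph-⨟ (swap n m) (swap m n) ⟩
    graph (swap m n ∘ swap n m)         ≈⟨ graph-cong (swap-involutive n m) ⟩
    graph (idᶠ (n + m))                 ≈⟨ ≐-sym (idᴿ-graph (n + m)) ⟩
    idᴿ X (n + m)                       ∎
    where open ≐-Reasoning

  swap-natural : ∀ {n m n' m'} (R : Rel n m) (S : Rel n' m') →
                 (R ⊗ S) ⨟ swapᴿ X m m' ≐ swapᴿ X n n' ⨟ (S ⊗ R)
  swap-natural {n} {m} {n'} {m'} R S = to , from
    where
    to : (R ⊗ S) ⨟ swapᴿ X m m' ⊆ swapᴿ X n n' ⨟ (S ⊗ R)
    to u w (t , (r , s) , refl) = swap n n' u , refl , ⊗-intro S R s r
    from : swapᴿ X n n' ⨟ (S ⊗ R) ⊆ (R ⊗ S) ⨟ swapᴿ X m m'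
    from u w (._ , refl , (s , r)) =
      swap m' m w ,
      (subst₂ R (drop-++ (drop n u) (take n u)) (sym (take-++ (drop m' w) (take m' w))) r ,
       subst₂ S (take-++ (drop n u) (take n u)) (sym (drop-++ (drop m' w) (take m' w))) s) ,
      sym (swap-involutive m' m w)

  ⨟-δᴿ : ∀ {n m} (R : Rel n m) → R ⨟ δᴿ X m ⊆ δᴿ X n ⨟ (R ⊗ R)
  ⨟-δᴿ R u .(v ++ v) (v , r , refl) = u ++ u , refl , ⊗-intro R R r r

  -- The body of the inductive definition δ_{n+1} = (δ ⊕ δ_n) ; (id ⊕ σ_{1,n} ⊕ id_n),
  -- read in Rel.  Up to transport it is copying on n + 1 entries.
  copyStep : ∀ n → Rel (suc n) (suc (n + 1 + n))
  copyStep n = (δᴿ X 1 ⊗ δᴿ X n) ⨟ (idᴿ X 1 ⊗ (swapᴿ X 1 n ⊗ idᴿ X n))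

  -- Moving x past b, as σ_{1,m} ⊕ id_n does on x ∷ (b ++ a).
  insert-after : ∀ {n m} x (a : Vec X n) (b : Vec X m) →
                 castᵛ (+-assoc m 1 n) ((swap 1 m ⊗ᶠ idᶠ n) (x ∷ (b ++ a))) ≡ b ++ (x ∷ a)
  insert-after {n} {m} x a b = begin
    castᵛ (+-assoc m 1 n) ((take m (b ++ a) ++ (x ∷ [])) ++ drop m (b ++ a))
      ≡⟨ cong₂ (λ p q → castᵛ (+-assoc m 1 n) ((p ++ (x ∷ [])) ++ q)) (take-++ b a) (drop-++ b a) ⟩
    castᵛ (+-assoc m 1 n) ((b ++ (x ∷ [])) ++ a)
      ≡⟨ ++-assoc-eqFree b (x ∷ []) a ⟩
    b ++ (x ∷ a) ∎
    where open ≡-Reasoning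

  copyStep-cast : ∀ n → castᴿ refl (cong suc (+-assoc n 1 n)) (copyStep n) ≐ δᴿ X (suc n)
  copyStep-cast n = begin
    castᴿ refl e (copyStep n)
      ≈⟨ castᴿ-cong refl e (⨟-cong copies-graph shuffle-graph) ⟩
    castᴿ refl e (graph copies ⨟ graph shuffle)
      ≈⟨ castᴿ-cong refl e (graph-⨟ copies shuffle) ⟩
    castᴿ refl e (graph (shuffle ∘ copies))
      ≈⟨ graph-cast e (shuffle ∘ copies) ⟩
    graph (castᵛ e ∘ shuffle ∘ copies)
      ≈⟨ graph-cong (λ { (x ∷ w) → cong (x ∷_) (insert-after x w w) }) ⟩
    δᴿ X (suc n) ∎
    where
    open ≐-Reasoning
    e : suc (n + 1 + n) ≡ suc (n + suc n)
    e = cong suc (+-assoc n 1 n)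
    -- copy the first entry and, separately, the remaining n entries,
    copies : Vec X (1 + n) → Vec X ((1 + 1) + (n + n))
    copies (x ∷ w) = x ∷ x ∷ (w ++ w)
    -- then move the second copy of the first entry past the next n entries
    shuffle : Vec X (1 + ((1 + n) + n)) → Vec X (1 + ((n + 1) + n))
    shuffle (x ∷ u) = x ∷ (swap 1 n ⊗ᶠ idᶠ n) u
    copies-graph : δᴿ X 1 ⊗ δᴿ X n ≐ graph copies
    copies-graph = (λ { (x ∷ w) v (p , q) → trans (sym (take++drop≡id 2 v)) (cong₂ _++_ p q) })
                 , (λ { (x ∷ w) v refl → refl , refl })
    shuffle-graph : idᴿ X 1 ⊗ (swapᴿ X 1 n ⊗ idᴿ X n) ≐ graph shuffle
    shuffle-graph = begin
      idᴿ X 1 ⊗ (swapᴿ X 1 n ⊗ idᴿ X n)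
        ≈⟨ ⊗-cong (idᴿ-graph 1) (⊗-congʳ (swapᴿ X 1 n) (idᴿ-graph n)) ⟩
      graph (idᶠ 1) ⊗ (graph (swap 1 n) ⊗ graph (idᶠ n))
        ≈⟨ ⊗-congʳ (graph (idᶠ 1)) (graph-⊗ (swap 1 n) (idᶠ n)) ⟩
      graph (idᶠ 1) ⊗ graph (swap 1 n ⊗ᶠ idᶠ n)
        ≈⟨ graph-⊗ (idᶠ 1) (swap 1 n ⊗ᶠ idᶠ n) ⟩
      graph (idᶠ 1 ⊗ᶠ (swap 1 n ⊗ᶠ idᶠ n))
        ≈⟨ graph-cong (λ { (x ∷ u) → refl }) ⟩
      graph shuffle ∎

  copyStep-ᵒ : ∀ n → (idᴿ X 1 ⊗ (swapᴿ X n 1 ⊗ idᴿ X n)) ⨟ (μᴿ X 1 ⊗ μᴿ X n) ≐ copyStep n ᵒ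
  copyStep-ᵒ n = begin
    (idᴿ X 1 ⊗ (swapᴿ X n 1 ⊗ idᴿ X n)) ⨟ (μᴿ X 1 ⊗ μᴿ X n)
      ≈⟨ ⨟-congˡ (μᴿ X 1 ⊗ μᴿ X n) (⊗-cong (idᴿ-ᵒ 1) (⊗-cong (swapᴿ-ᵒ n 1) (idᴿ-ᵒ n))) ⟩
    (idᴿ X 1 ⊗ (swapᴿ X 1 n ⊗ idᴿ X n)) ᵒ ⨟ (δᴿ X 1 ⊗ δᴿ X n) ᵒ
      ≈⟨ ≐-sym (⨟-ᵒ (δᴿ X 1 ⊗ δᴿ X n) (idᴿ X 1 ⊗ (swapᴿ X 1 n ⊗ idᴿ X n))) ⟩
    copyStep n ᵒ ∎
    where open ≐-Reasoning

module Semantics {Sym : Signature} {X : Set} (ρ : ∀ {n m} → Sym n m → VRel X n m) where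
  open Relations X

  ⟦_⟧ : ∀ {n m} → Term Sym n m → Rel n m
  ⟦ δ ⟧     = δᴿ X 1
  ⟦ ε ⟧     = εᴿ X 1
  ⟦ μ ⟧     = μᴿ X 1
  ⟦ η ⟧     = ηᴿ X 1
  ⟦ id₀ ⟧   = idᴿ X 0
  ⟦ id₁ ⟧   = idᴿ X 1
  ⟦ σ ⟧     = swapᴿ X 1 1
  ⟦ gen R ⟧ = ρ R
  ⟦ c ⨾ d ⟧ = ⟦ c ⟧ ⨟ ⟦ d ⟧
  ⟦ c ⊕ d ⟧ = ⟦ c ⟧ ⊗ ⟦ d ⟧

  ⟦cast⟧ : ∀ {n n' m m'} (p : n ≡ n') (q : m ≡ m') (c : Term Sym n m) →
           ⟦ cast p q c ⟧ ≐ castᴿ p q ⟦ c ⟧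
  ⟦cast⟧ refl refl c = ≐-sym (castᴿ-refl ⟦ c ⟧)

  ⟦idₙ⟧ : ∀ n → ⟦ idₙ n ⟧ ≐ idᴿ X n
  ⟦idₙ⟧ zero    = ≐-refl
  ⟦idₙ⟧ (suc n) = ≐-trans (⊗-congʳ (idᴿ X 1) (⟦idₙ⟧ n)) (⊗-id 1 n)

  ⟦idₙ⟧-graph : ∀ n → ⟦ idₙ n ⟧ ≐ graph (idᶠ n)
  ⟦idₙ⟧-graph n = ≐-trans (⟦idₙ⟧ n) (idᴿ-graph n)

  ⟦σ₁⟧ : ∀ m → ⟦ σ₁ m ⟧ ≐ swapᴿ X 1 m
  ⟦σ₁⟧ zero    = ≐-trans (idᴿ-graph 1) (graph-cong (λ { (x ∷ []) → refl }))
  ⟦σ₁⟧ (suc m) = begin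
    (swapᴿ X 1 1 ⊗ ⟦ idₙ m ⟧) ⨟ (idᴿ X 1 ⊗ ⟦ σ₁ m ⟧)
      ≈⟨ ⨟-cong (⊗-congʳ (swapᴿ X 1 1) (⟦idₙ⟧-graph m)) (⊗-cong (idᴿ-graph 1) (⟦σ₁⟧ m)) ⟩
    (graph (swap 1 1) ⊗ graph (idᶠ m)) ⨟ (graph (idᶠ 1) ⊗ graph (swap 1 m))
      ≈⟨ ⨟-cong (graph-⊗ (swap 1 1) (idᶠ m)) (graph-⊗ (idᶠ 1) (swap 1 m)) ⟩
    graph (swap 1 1 ⊗ᶠ idᶠ m) ⨟ graph (idᶠ 1 ⊗ᶠ swap 1 m)
      ≈⟨ graph-⨟ (swap 1 1 ⊗ᶠ idᶠ m) (idᶠ 1 ⊗ᶠ swap 1 m) ⟩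
    graph ((idᶠ 1 ⊗ᶠ swap 1 m) ∘ (swap 1 1 ⊗ᶠ idᶠ m))
      ≈⟨ graph-cong (λ { (x ∷ y ∷ w) → refl }) ⟩
    swapᴿ X 1 (suc m) ∎
    where open ≐-Reasoning

  ⟦σₙ⟧ : ∀ n m → ⟦ σₙ n m ⟧ ≐ swapᴿ X n m
  ⟦σₙ⟧ zero m = begin
    ⟦ cast refl e (idₙ m) ⟧         ≈⟨ ⟦cast⟧ refl e (idₙ m) ⟩
    castᴿ refl e ⟦ idₙ m ⟧          ≈⟨ castᴿ-cong refl e (⟦idₙ⟧-graph m) ⟩
    castᴿ refl e (graph (idᶠ m))    ≈⟨ graph-cast e (idᶠ m) ⟩
    graph (castᵛ e ∘ idᶠ m)         ≈⟨ graph-cong cast-++-[] ⟩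
    swapᴿ X 0 m                     ∎
    where
    open ≐-Reasoning
    e : m ≡ m + 0
    e = sym (+-identityʳ m)
  ⟦σₙ⟧ (suc n) m = begin
    (idᴿ X 1 ⊗ ⟦ σₙ n m ⟧) ⨟ ⟦ cast refl e (σ₁ m ⊕ idₙ n) ⟧
      ≈⟨ ⨟-cong (⊗-cong (idᴿ-graph 1) (⟦σₙ⟧ n m))
                (≐-trans (⟦cast⟧ refl e (σ₁ m ⊕ idₙ n))
                         (castᴿ-cong refl e (⊗-cong (⟦σ₁⟧ m) (⟦idₙ⟧-graph n)))) ⟩
    (graph (idᶠ 1) ⊗ graph (swap n m)) ⨟ castᴿ refl e (graph (swap 1 m) ⊗ graph (idᶠ n))
      ≈⟨ ⨟-cong (graph-⊗ (idᶠ 1) (swap n m))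
                (≐-trans (castᴿ-cong refl e (graph-⊗ (swap 1 m) (idᶠ n)))
                         (graph-cast e (swap 1 m ⊗ᶠ idᶠ n))) ⟩
    graph (idᶠ 1 ⊗ᶠ swap n m) ⨟ graph (castᵛ e ∘ (swap 1 m ⊗ᶠ idᶠ n))
      ≈⟨ graph-⨟ (idᶠ 1 ⊗ᶠ swap n m) (castᵛ e ∘ (swap 1 m ⊗ᶠ idᶠ n)) ⟩
    graph (castᵛ e ∘ (swap 1 m ⊗ᶠ idᶠ n) ∘ (idᶠ 1 ⊗ᶠ swap n m))
      ≈⟨ graph-cong swap-step ⟩
    swapᴿ X (suc n) m ∎
    where
    open ≐-Reasoning
    e : m + 1 + n ≡ m + suc n
    e = +-assoc m 1 n
    swap-step : ∀ u → castᵛ e ((swap 1 m ⊗ᶠ idᶠ n) ((idᶠ 1 ⊗ᶠ swap n m) u)) ≡ swap (suc n) m u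
    swap-step (x ∷ u) with splitAt n u
    ... | a , b , refl = insert-after x a b

  ⟦δₙ⟧ : ∀ n → ⟦ δₙ n ⟧ ≐ δᴿ X n
  ⟦δₙ⟧ zero    = (λ { [] [] _ → refl }) , (λ { [] [] _ → refl })
  ⟦δₙ⟧ (suc n) = begin
    ⟦ cast refl e body ⟧       ≈⟨ ⟦cast⟧ refl e body ⟩
    castᴿ refl e ⟦ body ⟧      ≈⟨ castᴿ-cong refl e (⨟-cong (⊗-congʳ (δᴿ X 1) (⟦δₙ⟧ n))
                                    (⊗-congʳ (idᴿ X 1) (⊗-cong (⟦σₙ⟧ 1 n) (⟦idₙ⟧ n)))) ⟩
    castᴿ refl e (copyStep n)  ≈⟨ copyStep-cast n ⟩
    δᴿ X (suc n)               ∎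
    where
    open ≐-Reasoning
    e : suc (n + 1 + n) ≡ suc (n + suc n)
    e = cong suc (+-assoc n 1 n)
    body : Term Sym (suc n) (suc (n + 1 + n))
    body = (δ ⊕ δₙ n) ⨾ (id₁ ⊕ (σₙ 1 n ⊕ idₙ n))

  ⟦μₙ⟧ : ∀ n → ⟦ μₙ n ⟧ ≐ μᴿ X n
  ⟦μₙ⟧ zero    = (λ { [] [] _ → refl }) , (λ { [] [] _ → refl })
  ⟦μₙ⟧ (suc n) = begin
    ⟦ cast e refl body ⟧        ≈⟨ ⟦cast⟧ e refl body ⟩
    castᴿ e refl ⟦ body ⟧       ≈⟨ castᴿ-cong e refl (⨟-cong (⊗-congʳ (idᴿ X 1) (⊗-cong (⟦σₙ⟧ n 1) (⟦idₙ⟧ n)))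
                                     (⊗-congʳ (μᴿ X 1) (⟦μₙ⟧ n))) ⟩
    castᴿ e refl ((idᴿ X 1 ⊗ (swapᴿ X n 1 ⊗ idᴿ X n)) ⨟ (μᴿ X 1 ⊗ μᴿ X n))
                                ≈⟨ castᴿ-cong e refl (copyStep-ᵒ n) ⟩
    castᴿ refl e (copyStep n) ᵒ ≈⟨ ᵒ-cong (copyStep-cast n) ⟩
    μᴿ X (suc n)                ∎
    where
    open ≐-Reasoning
    e : suc (n + 1 + n) ≡ suc (n + suc n)
    e = cong suc (+-assoc n 1 n)
    body : Term Sym (suc (n + 1 + n)) (suc n)
    body = (id₁ ⊕ (σₙ n 1 ⊕ idₙ n)) ⨾ (μ ⊕ μₙ n)

  ⟦εₙ⟧ : ∀ n → ⟦ εₙ n ⟧ ≐ εᴿ X n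
  ⟦εₙ⟧ n = (λ _ _ _ → tt) , (λ u v _ → total n u v)
    where
    total : ∀ n u v → ⟦ εₙ n ⟧ u v
    total zero    []      []  = refl
    total (suc n) (x ∷ u) v   = tt , total n u v

  ⟦ηₙ⟧ : ∀ n → ⟦ ηₙ n ⟧ ≐ ηᴿ X n
  ⟦ηₙ⟧ n = (λ _ _ _ → tt) , (λ u v _ → total n u v)
    where
    total : ∀ n u v → ⟦ ηₙ n ⟧ u v
    total zero    []  []      = refl
    total (suc n) u   (y ∷ v) = tt , total n u v

  -- The (co)monoid, Frobenius and speciality axioms only involve vectors of
  -- length at most three and are checked elementwise.
  ⟦⟧-≈ᴱ : ∀ {n m} {c d : Term Sym n m} → c ≈ᴱ d → ⟦ c ⟧ ≐ ⟦ d ⟧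
  ⟦⟧-≈ᴱ (⨾-assoc c d e)      = ⨟-assoc ⟦ c ⟧ ⟦ d ⟧ ⟦ e ⟧
  ⟦⟧-≈ᴱ (⨾-idˡ {n} c)        = ≐-trans (⨟-congˡ ⟦ c ⟧ (⟦idₙ⟧ n)) (⨟-identityˡ ⟦ c ⟧)
  ⟦⟧-≈ᴱ (⨾-idʳ {m = m} c)    = ≐-trans (⨟-congʳ ⟦ c ⟧ (⟦idₙ⟧ m)) (⨟-identityʳ ⟦ c ⟧)
  ⟦⟧-≈ᴱ (⊕-assoc {n} {m} {k} {l} {p} {q} c d e) =
    ≐-trans (⟦cast⟧ (+-assoc n k p) (+-assoc m l q) ((c ⊕ d) ⊕ e)) (⊗-assoc ⟦ c ⟧ ⟦ d ⟧ ⟦ e ⟧)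
  ⟦⟧-≈ᴱ (⊕-idˡ c)            = ⊗-identityˡ ⟦ c ⟧
  ⟦⟧-≈ᴱ (⊕-idʳ {n} {m} c)    =
    ≐-trans (⟦cast⟧ (+-identityʳ n) (+-identityʳ m) (c ⊕ id₀)) (⊗-identityʳ ⟦ c ⟧)
  ⟦⟧-≈ᴱ (⊕-id n m)           = ≐-trans (⊗-cong (⟦idₙ⟧ n) (⟦idₙ⟧ m))
                                 (≐-trans (⊗-id n m) (≐-sym (⟦idₙ⟧ (n + m))))
  ⟦⟧-≈ᴱ (interchange c d c' d') = ⨟-⊗-interchange ⟦ c ⟧ ⟦ d ⟧ ⟦ c' ⟧ ⟦ d' ⟧
  ⟦⟧-≈ᴱ σσ                   = ≐-trans (swap-inverse 1 1) (≐-sym (⊗-id 1 1))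
  ⟦⟧-≈ᴱ (σₙ-inv n m)         = ≐-trans (⨟-cong (⟦σₙ⟧ n m) (⟦σₙ⟧ m n))
                                 (≐-trans (swap-inverse n m) (≐-sym (⟦idₙ⟧ (n + m))))
  ⟦⟧-≈ᴱ (σₙ-nat {n} {m} {n'} {m'} c d) =
    ≐-trans (⨟-congʳ (⟦ c ⟧ ⊗ ⟦ d ⟧) (⟦σₙ⟧ m m'))
      (≐-trans (swap-natural ⟦ c ⟧ ⟦ d ⟧) (⨟-congˡ (⟦ d ⟧ ⊗ ⟦ c ⟧) (≐-sym (⟦σₙ⟧ n n'))))
  ⟦⟧-≈ᴱ δ-assoc = (λ { (x ∷ []) (.x ∷ .x ∷ c ∷ []) (_ , refl , (refl , refl)) → (x ∷ x ∷ []) , refl , refl , refl })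
                , (λ { (x ∷ []) (.x ∷ b ∷ c ∷ []) (_ , refl , (refl , refl)) → (x ∷ x ∷ []) , refl , refl , refl })
  ⟦⟧-≈ᴱ δ-unitˡ = (λ { (x ∷ []) v (_ , refl , (tt , q)) → q })
                , (λ { (x ∷ []) .(x ∷ []) refl → (x ∷ x ∷ []) , refl , (tt , refl) })
  ⟦⟧-≈ᴱ δ-unitʳ = (λ { (x ∷ []) (y ∷ []) (_ , refl , (q , tt)) → q })
                , (λ { (x ∷ []) .(x ∷ []) refl → (x ∷ x ∷ []) , refl , (refl , tt) })
  ⟦⟧-≈ᴱ δ-comm  = (λ { (x ∷ []) v (_ , refl , q) → q })
                , (λ { (x ∷ []) v p → (x ∷ x ∷ []) , refl , p })
  ⟦⟧-≈ᴱ μ-assoc = (λ { (a ∷ b ∷ c ∷ []) (y ∷ []) ((_ ∷ _ ∷ []) , (refl , refl) , refl) → (y ∷ y ∷ []) , (refl , refl) , refl })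
                , (λ { (a ∷ b ∷ c ∷ []) (y ∷ []) ((_ ∷ _ ∷ []) , (refl , refl) , refl) → (y ∷ y ∷ []) , (refl , refl) , refl })
  ⟦⟧-≈ᴱ μ-unitˡ = (λ { (x ∷ []) (y ∷ []) ((_ ∷ _ ∷ []) , (tt , refl) , refl) → refl })
                , (λ { (x ∷ []) .(x ∷ []) refl → (x ∷ x ∷ []) , (tt , refl) , refl })
  ⟦⟧-≈ᴱ μ-unitʳ = (λ { (x ∷ []) (y ∷ []) ((_ ∷ _ ∷ []) , (refl , tt) , refl) → refl })
                , (λ { (x ∷ []) .(x ∷ []) refl → (x ∷ x ∷ []) , (refl , tt) , refl })
  ⟦⟧-≈ᴱ μ-comm  = (λ { (a ∷ b ∷ []) (y ∷ []) (_ , refl , refl) → refl })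
                , (λ { (a ∷ b ∷ []) (y ∷ []) refl → (y ∷ y ∷ []) , refl , refl })
  ⟦⟧-≈ᴱ frobˡ   = (λ { (a ∷ b ∷ []) (c ∷ d ∷ []) ((_ ∷ _ ∷ _ ∷ []) , (refl , refl) , (refl , refl)) → (a ∷ []) , refl , refl })
                , (λ { (a ∷ b ∷ []) (c ∷ d ∷ []) ((s ∷ []) , refl , refl) → (s ∷ s ∷ s ∷ []) , (refl , refl) , (refl , refl) })
  ⟦⟧-≈ᴱ frobʳ   = (λ { (a ∷ b ∷ []) (c ∷ d ∷ []) ((_ ∷ _ ∷ _ ∷ []) , (refl , refl) , (refl , refl)) → (a ∷ []) , refl , refl })
                , (λ { (a ∷ b ∷ []) (c ∷ d ∷ []) ((s ∷ []) , refl , refl) → (s ∷ s ∷ s ∷ []) , (refl , refl) , (refl , refl) })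
  ⟦⟧-≈ᴱ special = (λ { (x ∷ []) (y ∷ []) (_ , refl , refl) → refl })
                , (λ { (x ∷ []) .(x ∷ []) refl → (x ∷ x ∷ []) , refl , refl })

  -- Soundness of ≤CB: the interpretation is monotone.  The inequalities (I) on
  -- generators hold because every relation is a lax comonoid homomorphism.
  ⟦⟧-mono : ∀ {n m} {c d : Term Sym n m} → c ≤CB d → ⟦ c ⟧ ⊆ ⟦ d ⟧
  ⟦⟧-mono ≤-refl          = λ _ _ r → r
  ⟦⟧-mono (≤-trans p q)   = ⊆-trans (⟦⟧-mono p) (⟦⟧-mono q)
  ⟦⟧-mono (≤-⨾ p q)       = ⨟-mono (⟦⟧-mono p) (⟦⟧-mono q)
  ⟦⟧-mono (≤-⊕ p q)       = ⊗-mono (⟦⟧-mono p) (⟦⟧-mono q)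
  ⟦⟧-mono (eq→ e)         = _≐_.to (⟦⟧-≈ᴱ e)
  ⟦⟧-mono (eq← e)         = _≐_.from (⟦⟧-≈ᴱ e)
  ⟦⟧-mono ε-η (x ∷ []) .(x ∷ []) refl = [] , tt , tt
  ⟦⟧-mono η-ε [] [] _     = refl
  ⟦⟧-mono δ-μ (x ∷ []) .(x ∷ []) refl = (x ∷ x ∷ []) , refl , refl
  ⟦⟧-mono μ-δ (a ∷ b ∷ []) (c ∷ d ∷ []) ((_ ∷ []) , refl , refl) = refl , refl
  ⟦⟧-mono (gen-δ {n} {m} R) =
    ⊆-trans (⨟-mono (λ _ _ r → r) (_≐_.to (⟦δₙ⟧ m)))
      (⊆-trans (⨟-δᴿ (ρ R)) (⨟-mono (_≐_.from (⟦δₙ⟧ n)) (λ _ _ r → r)))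
  ⟦⟧-mono (gen-ε {n} R) u v _ = _≐_.from (⟦εₙ⟧ n) u v tt


-- The equivalence ≤CB ∩ ≥CB, whose classes are the arrows of CB_Σ.
module TermEquivalence {Sym : Signature} where

  infix 4 _≅_
  _≅_ : ∀ {n m} → Term Sym n m → Term Sym n m → Set
  c ≅ d = c ≤CB d × d ≤CB c

  ≈ᴱ⇒≅ : ∀ {n m} {c d : Term Sym n m} → c ≈ᴱ d → c ≅ d
  ≈ᴱ⇒≅ e = eq→ e , eq← e

  ≅-⨾ : ∀ {n k m} {c c' : Term Sym n k} {d d' : Term Sym k m} → c ≅ c' → d ≅ d' → c ⨾ d ≅ c' ⨾ d'
  ≅-⨾ (p , q) (p' , q') = ≤-⨾ p p' , ≤-⨾ q q'

  ≅-⊕ : ∀ {n m k l} {c c' : Term Sym n m} {d d' : Term Sym k l} → c ≅ c' → d ≅ d' → c ⊕ d ≅ c' ⊕ d'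
  ≅-⊕ (p , q) (p' , q') = ≤-⊕ p p' , ≤-⊕ q q'

  ≅-refl : ∀ {n m} {c : Term Sym n m} → c ≅ c
  ≅-refl = ≤-refl , ≤-refl

  ≅-sym : ∀ {n m} {c d : Term Sym n m} → c ≅ d → d ≅ c
  ≅-sym (p , q) = q , p

  ≅-setoid : ℕ → ℕ → Setoid 0ℓ 0ℓ
  ≅-setoid n m = record
    { Carrier = Term Sym n m
    ; _≈_ = _≅_
    ; isEquivalence = record
      { refl  = ≅-refl
      ; sym   = ≅-sym
      ; trans = λ (p , q) (p' , q') → ≤-trans p p' , ≤-trans q' q } }

  module ≅-Reasoning {n m : ℕ} = SetoidReasoning (≅-setoid n m)

  idₙ-1 : idₙ 1 ≅ id₁
  idₙ-1 = ≈ᴱ⇒≅ (⊕-idʳ id₁)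

  εₙ-1 : εₙ 1 ≅ ε
  εₙ-1 = ≈ᴱ⇒≅ (⊕-idʳ ε)

  ηₙ-1 : ηₙ 1 ≅ η
  ηₙ-1 = ≈ᴱ⇒≅ (⊕-idʳ η)

  σₙ-1-1 : σₙ 1 1 ≅ σ
  σₙ-1-1 = begin
    idₙ 2 ⨾ (σ₁ 1 ⊕ id₀)             ≈⟨ ≈ᴱ⇒≅ (⨾-idˡ (σ₁ 1 ⊕ id₀)) ⟩
    σ₁ 1 ⊕ id₀                       ≈⟨ ≈ᴱ⇒≅ (⊕-idʳ (σ₁ 1)) ⟩
    (σ ⊕ id₀) ⨾ (id₁ ⊕ id₁)          ≈⟨ ≅-⨾ ≅-refl (≅-⊕ ≅-refl (≅-sym idₙ-1)) ⟩
    (σ ⊕ id₀) ⨾ idₙ 2                ≈⟨ ≈ᴱ⇒≅ (⨾-idʳ (σ ⊕ id₀)) ⟩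
    σ ⊕ id₀                          ≈⟨ ≈ᴱ⇒≅ (⊕-idʳ σ) ⟩
    σ                                ∎
    where open ≅-Reasoning

  δₙ-1 : δₙ 1 ≅ δ
  δₙ-1 = begin
    (δ ⊕ id₀) ⨾ (id₁ ⊕ (σₙ 1 0 ⊕ id₀)) ≈⟨ ≅-⨾ ≅-refl (≅-⊕ ≅-refl (≅-⊕ (≈ᴱ⇒≅ (⨾-idˡ (idₙ 1))) ≅-refl)) ⟩
    (δ ⊕ id₀) ⨾ (id₁ ⊕ (idₙ 1 ⊕ id₀))   ≈⟨ ≅-⨾ ≅-refl (≅-⊕ ≅-refl (≈ᴱ⇒≅ (⊕-id 1 0))) ⟩
    (δ ⊕ id₀) ⨾ idₙ 2                    ≈⟨ ≈ᴱ⇒≅ (⨾-idʳ (δ ⊕ id₀)) ⟩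
    δ ⊕ id₀                              ≈⟨ ≈ᴱ⇒≅ (⊕-idʳ δ) ⟩
    δ                                    ∎
    where open ≅-Reasoning

  μₙ-1 : μₙ 1 ≅ μ
  μₙ-1 = begin
    (id₁ ⊕ (idₙ 1 ⊕ id₀)) ⨾ (μ ⊕ id₀)   ≈⟨ ≅-⨾ (≅-⊕ ≅-refl (≈ᴱ⇒≅ (⊕-id 1 0))) ≅-refl ⟩
    idₙ 2 ⨾ (μ ⊕ id₀)                    ≈⟨ ≈ᴱ⇒≅ (⨾-idˡ (μ ⊕ id₀)) ⟩
    μ ⊕ id₀                              ≈⟨ ≈ᴱ⇒≅ (⊕-idʳ μ) ⟩
    μ                                    ∎
    where open ≅-Reasoning

module _ {Sym : Signature} {X : Set} where
  open Relations X
  open TermEquivalence {Sym}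

  toMorphism : Model Sym X → CBMorphism Sym X
  toMorphism M = record
    { F       = ⟦_⟧
    ; mono    = ⟦⟧-mono
    ; pres-⨾  = λ c d → ≐⇒≐ᴿ ≐-refl
    ; pres-id = λ n → ≐⇒≐ᴿ (⟦idₙ⟧ n)
    ; pres-⊕  = λ c d → ≐⇒≐ᴿ ≐-refl
    ; pres-σ  = λ n m → ≐⇒≐ᴿ (⟦σₙ⟧ n m)
    ; pres-δ  = λ n → ≐⇒≐ᴿ (⟦δₙ⟧ n)
    ; pres-ε  = λ n → ≐⇒≐ᴿ (⟦εₙ⟧ n)
    ; pres-μ  = λ n → ≐⇒≐ᴿ (⟦μₙ⟧ n)
    ; pres-η  = λ n → ≐⇒≐ᴿ (⟦ηₙ⟧ n) }
    where open Semantics (Model.ρ M)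

  toModel : CBMorphism Sym X → Model Sym X
  toModel G = record { ρ = λ R → CBMorphism.F G (gen R) }

  ⟦⟧-resp : ∀ {M N : Model Sym X} → M ≈Model N → ∀ {n m} (c : Term Sym n m) →
            Semantics.⟦_⟧ (Model.ρ M) c ≐ Semantics.⟦_⟧ (Model.ρ N) c
  ⟦⟧-resp M≈N δ       = ≐-refl
  ⟦⟧-resp M≈N ε       = ≐-refl
  ⟦⟧-resp M≈N μ       = ≐-refl
  ⟦⟧-resp M≈N η       = ≐-refl
  ⟦⟧-resp M≈N id₀     = ≐-refl
  ⟦⟧-resp M≈N id₁     = ≐-refl
  ⟦⟧-resp M≈N σ       = ≐-refl
  ⟦⟧-resp M≈N (gen R) = ≐ᴿ⇒≐ (M≈N R)
  ⟦⟧-resp M≈N (c ⨾ d) = ⨟-cong (⟦⟧-resp M≈N c) (⟦⟧-resp M≈N d)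
  ⟦⟧-resp M≈N (c ⊕ d) = ⊗-cong (⟦⟧-resp M≈N c) (⟦⟧-resp M≈N d)

  -- On the constants this uses that a
  -- morphism preserves the n-fold structure at n = 1 and respects ≅.
  morphism-determined : (G : CBMorphism Sym X) → ∀ {n m} (c : Term Sym n m) →
                        Semantics.⟦_⟧ (Model.ρ (toModel G)) c ≐ CBMorphism.F G c
  morphism-determined G = go
    where
    open CBMorphism G
    open Semantics (Model.ρ (toModel G))
    F-resp : ∀ {n m} {c d : Term Sym n m} → c ≅ d → F c ≐ F d
    F-resp (c≤d , d≤c) = mono c≤d , mono d≤c
    go : ∀ {n m} (c : Term Sym n m) → ⟦ c ⟧ ≐ F c
    go δ       = ≐-trans (≐-sym (≐ᴿ⇒≐ (pres-δ 1))) (F-resp δₙ-1)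
    go ε       = ≐-trans (≐-sym (≐ᴿ⇒≐ (pres-ε 1))) (F-resp εₙ-1)
    go μ       = ≐-trans (≐-sym (≐ᴿ⇒≐ (pres-μ 1))) (F-resp μₙ-1)
    go η       = ≐-trans (≐-sym (≐ᴿ⇒≐ (pres-η 1))) (F-resp ηₙ-1)
    go id₀     = ≐-sym (≐ᴿ⇒≐ (pres-id 0))
    go id₁     = ≐-trans (≐-sym (≐ᴿ⇒≐ (pres-id 1))) (F-resp idₙ-1)
    go σ       = ≐-trans (≐-sym (≐ᴿ⇒≐ (pres-σ 1 1))) (F-resp σₙ-1-1)
    go (gen R) = ≐-refl
    go (c ⨾ d) = ≐-trans (⨟-cong (go c) (go d)) (≐-sym (≐ᴿ⇒≐ (pres-⨾ c d)))
    go (c ⊕ d) = ≐-trans (⊗-cong (go c) (go d)) (≐-sym (≐ᴿ⇒≐ (pres-⊕ c d)))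

mainTheorem8 : (Sym : Signature) (X : Set) →
    Inverse (ModelSetoid Sym X) (MorphismSetoid Sym X)
mainTheorem8 Sym X = record
  { to        = toMorphism
  ; from      = toModel
  ; to-cong   = λ M≈N c → ≐⇒≐ᴿ (⟦⟧-resp M≈N c)
  ; from-cong = λ F≈G R → F≈G (gen R)
  ; inverse   = (λ {G} M≈G c → ≐⇒≐ᴿ (≐-trans (⟦⟧-resp M≈G c) (morphism-determined G c)))
              , (λ G≈M R → G≈M (gen R))
  }
  where open Relations X
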